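{- For every path $P_m$ (the path with $m$ edges and $m+1$ vertices, $m\ge 1$), $\mathsf{DL}(P_m) = r(P_m)$, where $r(P_m)=m/2$ if $m$ is even and $r(P_m)=(m+1)/2$ if $m$ is odd.
   Context: For a finite connected graph $G=(V,E)$ with $|V|=n$ and graph distance $d$, a $k$-dispersed labelling is a bijection $\phi:\{1,\dots,n\}\to V$ with $d(\phi(i),\phi(i+1))\ge k$ for $1\le i\le n-1$. $\mathsf{DL}(G)$ is the maximum $k$ such that $G$ has a $k$-dispersed labelling. $r(G)$ denotes the radius $\min_{v}\max_{u} d(v,u)$. -}

module Defs where

open import Data.Nat using (ℕ; zero; suc; _+_; _≤_)
open import Data.Fin using (Fin; toℕ)
open import Data.Sum using (_⊎_)
open import Data.Product using (Σ; ∃; _×_)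
open import Function.Bundles using (_⤖_; Bijection)
open import Relation.Binary.PropositionalEquality using (_≡_)

record Graph (n : ℕ) : Set₁ where
  field
    Adj : Fin n → Fin n → Set

open Graph public

data Walk {n : ℕ} (G : Graph n) : Fin n → Fin n → ℕ → Set where
  here : ∀ {u} → Walk G u u 0
  step : ∀ {u v w ℓ} → Adj G u v → Walk G v w ℓ → Walk G u w (suc ℓ)

Dist : ∀ {n} → Graph n → Fin n → Fin n → ℕ → Set
Dist G u v δ = Walk G u v δ × (∀ ℓ → Walk G u v ℓ → δ ≤ ℓ)

-- Labellings: bijections from the label set {1..n} (encoded as Fin n) to V.
Labelling : ℕ → Set
Labelling n = Fin n ⤖ Fin n

Dispersed : ∀ {n} → Graph n → ℕ → Labelling n → Set
Dispersed {n} G k φ =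
  ∀ (i j : Fin n) → toℕ j ≡ suc (toℕ i) →
  ∀ δ → Dist G (Bijection.to φ i) (Bijection.to φ j) δ → k ≤ δ

IsDL : ∀ {n} → Graph n → ℕ → Set
IsDL {n} G k =
  (Σ (Labelling n) λ φ → Dispersed G k φ) ×
  (∀ k′ → (φ : Labelling n) → Dispersed G k′ φ → k′ ≤ k)

IsEcc : ∀ {n} → Graph n → Fin n → ℕ → Set
IsEcc {n} G v e =
  (∀ u δ → Dist G v u δ → δ ≤ e) × (∃ λ u → Dist G v u e)

IsRadius : ∀ {n} → Graph n → ℕ → Set
IsRadius {n} G r =
  (∃ λ v → IsEcc G v r) × (∀ v e → IsEcc G v e → r ≤ e)

PathGraph : (m : ℕ) → Graph (suc m)
PathGraph m = record
  { Adj = λ i j → (suc (toℕ i) ≡ toℕ j) ⊎ (suc (toℕ j) ≡ toℕ i) }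

-- In any labelling of a connected graph with at least two vertices, a centre and
-- some other vertex carry consecutive labels, and that vertex lies within r(G) of
-- the centre; hence DL(G) ≤ r(G). On Pₘ, with h = ⌈m/2⌉, the labelling that alternates between the
-- upper half h, h+1, … and the lower half 0, 1, … (vertex order h, 0, h+1, 1, …)
-- moves distance h or h+1 at every step, so DL(Pₘ) ≥ h; and the eccentricity of
-- vertex v is max(v, m − v), which is minimal, equal to h, at v = ⌊m/2⌋.
module Submission where

open import Defs
open import Data.Nat using (ℕ; _≤_; ⌈_/2⌉)
open import Data.Product using (∃; _×_)
open import Relation.Binary.PropositionalEquality using (_≡_)

open import Data.Nat using (zero; suc; _+_; _∸_; _⊔_; _<_; ⌊_/2⌋; ∣_-_∣; s≤s; s≤s⁻¹)
open import Data.Nat.Properties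
open import Data.Fin using (Fin; toℕ; fromℕ<; fromℕ; inject₁)
open import Data.Fin.Properties using (toℕ-injective; toℕ<n; toℕ-fromℕ<; toℕ-fromℕ; toℕ-inject₁)
open import Data.Product using (Σ; ∃₂; _,_; proj₁; proj₂)
open import Data.Sum using (inj₁; inj₂; _⊎_; swap)
open import Data.Empty using (⊥-elim)
open import Relation.Nullary using (yes; no)
open import Relation.Binary.Definitions using (Symmetric)
open import Relation.Binary.PropositionalEquality using (refl; sym; trans; cong; cong₂; subst; module ≡-Reasoning)
open import Function.Bundles using (_⤖_; Bijection; mk↔ₛ′)
open import Function.Properties.Inverse using (↔⇒⤖)

open Bijection using (to)

Connected : ∀ {n} → Graph n → Set
Connected G = ∀ u v → ∃ (Dist G u v)

module _ {n} {G : Graph n} where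

  snoc : ∀ {u v w ℓ} → Walk G u v ℓ → Adj G v w → Walk G u w (suc ℓ)
  snoc here         e = step e here
  snoc (step e′ p)  e = step e′ (snoc p e)

  reverse : Symmetric (Adj G) → ∀ {u v ℓ} → Walk G u v ℓ → Walk G v u ℓ
  reverse adj-sym here       = here
  reverse adj-sym (step e p) = snoc (reverse adj-sym p) (adj-sym e)

  Dist-sym : Symmetric (Adj G) → ∀ {u v δ} → Dist G u v δ → Dist G v u δ
  Dist-sym adj-sym (p , shortest) =
    reverse adj-sym p , λ ℓ q → shortest ℓ (reverse adj-sym q)

  Dist-unique : ∀ {u v δ δ′} → Dist G u v δ → Dist G u v δ′ → δ ≡ δ′
  Dist-unique (p , shortest) (p′ , shortest′) = ≤-antisym (shortest _ p′) (shortest′ _ p)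

  IsEcc-unique : ∀ {v e e′} → IsEcc G v e → IsEcc G v e′ → e ≡ e′
  IsEcc-unique {e = e} {e′} (bounded , u , d) (bounded′ , u′ , d′) =
    ≤-antisym (bounded′ u e d) (bounded u′ e′ d′)

consecutive-labels : ∀ {n} → 1 ≤ n → (φ : Labelling (suc n)) (v : Fin (suc n)) →
  ∃₂ λ i j → toℕ j ≡ suc (toℕ i) × (to φ i ≡ v ⊎ to φ j ≡ v)
consecutive-labels 1≤n φ v with Bijection.strictlySurjective φ v
... | Fin.zero , φ0≡v = Fin.zero , fromℕ< (s≤s 1≤n) , toℕ-fromℕ< (s≤s 1≤n) , inj₁ φ0≡v
... | Fin.suc i , φi≡v = inject₁ i , Fin.suc i , cong suc (sym (toℕ-inject₁ i)) , inj₂ φi≡v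

dispersed≤eccentricity : ∀ {n} {G : Graph (suc n)} → 1 ≤ n → Symmetric (Adj G) → Connected G →
  ∀ {k φ v e} → Dispersed G k φ → IsEcc G v e → k ≤ e
dispersed≤eccentricity 1≤n adj-sym connected {φ = φ} {v} dispersed (bounded , _)
  with i , j , j≡1+i , centre-labelled ← consecutive-labels 1≤n φ v
  with δ , d ← connected (to φ i) (to φ j)
  = ≤-trans (dispersed i j j≡1+i δ d) (from-centre centre-labelled)
  where
    from-centre : to φ i ≡ v ⊎ to φ j ≡ v → δ ≤ _
    from-centre (inj₁ refl) = bounded _ δ d
    from-centre (inj₂ refl) = bounded _ δ (Dist-sym adj-sym d)

dispersed≤radius : ∀ {n} {G : Graph (suc n)} → 1 ≤ n → Symmetric (Adj G) → Connected G →
  ∀ {k r} → IsRadius G r → (φ : Labelling (suc n)) → Dispersed G k φ → k ≤ r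
dispersed≤radius 1≤n adj-sym connected ((_ , ecc) , _) φ dispersed =
  dispersed≤eccentricity 1≤n adj-sym connected {φ = φ} dispersed ecc

∣n-1+n∣≡1 : ∀ n → ∣ n - suc n ∣ ≡ 1
∣n-1+n∣≡1 zero    = refl
∣n-1+n∣≡1 (suc n) = ∣n-1+n∣≡1 n

∣m-n∣≤m⊔[o∸m] : ∀ m {n o} → n ≤ o → ∣ m - n ∣ ≤ m ⊔ (o ∸ m)
∣m-n∣≤m⊔[o∸m] m {n} {o} n≤o with ∣m-n∣≡[m∸n]∨[n∸m] m n
... | inj₁ eq = ≤-trans (≤-reflexive eq) (≤-trans (m∸n≤m m n) (m≤m⊔n m (o ∸ m)))
... | inj₂ eq = ≤-trans (≤-reflexive eq) (≤-trans (∸-monoˡ-≤ m n≤o) (m≤n⊔m m (o ∸ m)))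

⌈n/2⌉≤m⊔[n∸m] : ∀ n m → ⌈ n /2⌉ ≤ m ⊔ (n ∸ m)
⌈n/2⌉≤m⊔[n∸m] n m = begin
  ⌈ n /2⌉      ≤⟨ ⌈n/2⌉-mono n≤x+x ⟩
  ⌈ x + x /2⌉  ≡⟨ n≡⌈n+n/2⌉ x ⟨
  x            ∎
  where
    open ≤-Reasoning
    x : ℕ
    x = m ⊔ (n ∸ m)
    n≤x+x : n ≤ x + x
    n≤x+x = ≤-trans (m≤n+m∸n n m) (+-mono-≤ (m≤m⊔n m (n ∸ m)) (m≤n⊔m m (n ∸ m)))

n∸⌊n/2⌋≡⌈n/2⌉ : ∀ n → n ∸ ⌊ n /2⌋ ≡ ⌈ n /2⌉
n∸⌊n/2⌋≡⌈n/2⌉ n = trans (cong (_∸ ⌊ n /2⌋) (sym (⌊n/2⌋+⌈n/2⌉≡n n))) (m+n∸m≡n ⌊ n /2⌋ ⌈ n /2⌉)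

n∸⌈n/2⌉≡⌊n/2⌋ : ∀ n → n ∸ ⌈ n /2⌉ ≡ ⌊ n /2⌋
n∸⌈n/2⌉≡⌊n/2⌋ n = trans (cong (_∸ ⌈ n /2⌉) (sym (⌊n/2⌋+⌈n/2⌉≡n n))) (m+n∸n≡m ⌊ n /2⌋ ⌈ n /2⌉)

t+t≤n⇒t≤⌊n/2⌋ : ∀ {t n} → t + t ≤ n → t ≤ ⌊ n /2⌋
t+t≤n⇒t≤⌊n/2⌋ {t} t+t≤n = subst (_≤ _) (sym (n≡⌊n+n/2⌋ t)) (⌊n/2⌋-mono t+t≤n)

1+t+t≤n⇒t<⌈n/2⌉ : ∀ {t n} → suc (t + t) ≤ n → t < ⌈ n /2⌉
1+t+t≤n⇒t<⌈n/2⌉ {t} 1+t+t≤n = subst (λ x → suc x ≤ _) (sym (n≡⌊n+n/2⌋ t)) (⌈n/2⌉-mono 1+t+t≤n)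

t<⌈n/2⌉⇒1+t+t≤n : ∀ {t n} → t < ⌈ n /2⌉ → suc (t + t) ≤ n
t<⌈n/2⌉⇒1+t+t≤n {t} {n} t<⌈n/2⌉ = ≰⇒> λ n≤t+t →
  <⇒≱ t<⌈n/2⌉ (subst (⌈ n /2⌉ ≤_) (sym (n≡⌈n+n/2⌉ t)) (⌈n/2⌉-mono n≤t+t))

data Parity : ℕ → Set where
  even : ∀ t → Parity (t + t)
  odd  : ∀ t → Parity (suc (t + t))

parity : ∀ p → Parity p
parity zero = even zero
parity (suc p) with parity p
... | even t = odd t
... | odd t  = subst Parity (cong suc (+-suc t t)) (even (suc t))

⤖-from-inverses-on-range : ∀ {n} (f g : ℕ → ℕ) →
  (∀ {p} → p < n → f p < n) → (∀ {v} → v < n → g v < n) →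
  (∀ {p} → p < n → g (f p) ≡ p) → (∀ {v} → v < n → f (g v) ≡ v) →
  Σ (Fin n ⤖ Fin n) λ φ → ∀ i → toℕ (to φ i) ≡ f (toℕ i)
⤖-from-inverses-on-range f g f< g< gf fg =
  ↔⇒⤖ (mk↔ₛ′ f′ g′
    (λ v → toℕ-injective (trans (toℕ-f′ (g′ v)) (trans (cong f (toℕ-g′ v)) (fg (toℕ<n v)))))
    (λ p → toℕ-injective (trans (toℕ-g′ (f′ p)) (trans (cong g (toℕ-f′ p)) (gf (toℕ<n p))))))
  , toℕ-f′
  where
    f′ g′ : Fin _ → Fin _
    f′ p = fromℕ< (f< (toℕ<n p))
    g′ v = fromℕ< (g< (toℕ<n v))
    toℕ-f′ : ∀ p → toℕ (f′ p) ≡ f (toℕ p)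
    toℕ-f′ p = toℕ-fromℕ< (f< (toℕ<n p))
    toℕ-g′ : ∀ v → toℕ (g′ v) ≡ g (toℕ v)
    toℕ-g′ v = toℕ-fromℕ< (g< (toℕ<n v))

module Path (m : ℕ) where

  private
    P : Graph (suc m)
    P = PathGraph m

  adj-sym : Symmetric (Adj P)
  adj-sym = swap

  adj⇒∣-∣≡1 : ∀ {u v} → Adj P u v → ∣ toℕ u - toℕ v ∣ ≡ 1
  adj⇒∣-∣≡1 {u}     (inj₁ 1+u≡v) = subst (λ x → ∣ toℕ u - x ∣ ≡ 1) 1+u≡v (∣n-1+n∣≡1 (toℕ u))
  adj⇒∣-∣≡1 {v = v} (inj₂ 1+v≡u) =
    subst (λ x → ∣ x - toℕ v ∣ ≡ 1) 1+v≡u (trans (∣-∣-comm (suc (toℕ v)) (toℕ v)) (∣n-1+n∣≡1 (toℕ v)))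

  walk-length : ∀ {u v ℓ} → Walk P u v ℓ → ∣ toℕ u - toℕ v ∣ ≤ ℓ
  walk-length {u} here = ≤-reflexive (∣n-n∣≡0 (toℕ u))
  walk-length {u} {w} (step {v = v} e p) = begin
    ∣ toℕ u - toℕ w ∣                    ≤⟨ ∣-∣-triangle (toℕ u) (toℕ v) (toℕ w) ⟩
    ∣ toℕ u - toℕ v ∣ + ∣ toℕ v - toℕ w ∣ ≡⟨ cong (_+ ∣ toℕ v - toℕ w ∣) (adj⇒∣-∣≡1 e) ⟩
    suc ∣ toℕ v - toℕ w ∣                ≤⟨ s≤s (walk-length p) ⟩
    _                                   ∎
    where open ≤-Reasoning

  ascending-walk : ∀ d {u v} → toℕ u + d ≡ toℕ v → Walk P u v d
  ascending-walk zero {u} u+0≡v =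
    subst (λ v → Walk P u v 0) (toℕ-injective (trans (sym (+-identityʳ (toℕ u))) u+0≡v)) here
  ascending-walk (suc d) {u} {v} u+1+d≡v =
    step (inj₁ (sym (toℕ-fromℕ< 1+u<1+m)))
         (ascending-walk d (trans (cong (_+ d) (toℕ-fromℕ< 1+u<1+m)) 1+u+d≡v))
    where
      1+u+d≡v : suc (toℕ u) + d ≡ toℕ v
      1+u+d≡v = trans (sym (+-suc (toℕ u) d)) u+1+d≡v
      1+u<1+m : suc (toℕ u) < suc m
      1+u<1+m = ≤-<-trans (≤-trans (m≤m+n (suc (toℕ u)) d) (≤-reflexive 1+u+d≡v)) (toℕ<n v)

  dist : ∀ u v → Dist P u v ∣ toℕ u - toℕ v ∣
  dist u v = shortest-walk , λ ℓ → walk-length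
    where
      shortest-walk : Walk P u v ∣ toℕ u - toℕ v ∣
      shortest-walk with ≤-total (toℕ u) (toℕ v)
      ... | inj₁ u≤v = subst (Walk P u v) (sym (m≤n⇒∣m-n∣≡n∸m u≤v))
                         (ascending-walk _ (m+[n∸m]≡n u≤v))
      ... | inj₂ v≤u = subst (Walk P u v) (sym (m≤n⇒∣n-m∣≡n∸m v≤u))
                         (reverse adj-sym (ascending-walk _ (m+[n∸m]≡n v≤u)))

  connected : Connected P
  connected u v = _ , dist u v

  dist-≡ : ∀ {u v δ} → Dist P u v δ → δ ≡ ∣ toℕ u - toℕ v ∣
  dist-≡ {u} {v} d = Dist-unique d (dist u v)

  toℕ≤m : ∀ (v : Fin (suc m)) → toℕ v ≤ m
  toℕ≤m v = s≤s⁻¹ (toℕ<n v)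

  far-end : ∀ v → ∃ λ u → ∣ toℕ v - toℕ u ∣ ≡ toℕ v ⊔ (m ∸ toℕ v)
  far-end v with ⊔-sel (toℕ v) (m ∸ toℕ v)
  ... | inj₁ ⊔≡v   = Fin.zero , trans (∣-∣-identityʳ (toℕ v)) (sym ⊔≡v)
  ... | inj₂ ⊔≡m∸v = fromℕ m , (begin
    ∣ toℕ v - toℕ (fromℕ m) ∣ ≡⟨ cong (∣ toℕ v -_∣) (toℕ-fromℕ m) ⟩
    ∣ toℕ v - m ∣             ≡⟨ m≤n⇒∣m-n∣≡n∸m (toℕ≤m v) ⟩
    m ∸ toℕ v                ≡⟨ ⊔≡m∸v ⟨
    toℕ v ⊔ (m ∸ toℕ v)      ∎)
    where open ≡-Reasoning

  eccentricity : ∀ v → IsEcc P v (toℕ v ⊔ (m ∸ toℕ v))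
  eccentricity v with u , far ← far-end v = bounded , u , subst (Dist P v u) far (dist v u)
    where
      bounded : ∀ u δ → Dist P v u δ → δ ≤ toℕ v ⊔ (m ∸ toℕ v)
      bounded u δ d = subst (_≤ _) (sym (dist-≡ d)) (∣m-n∣≤m⊔[o∸m] (toℕ v) (toℕ≤m u))

  isRadius : IsRadius P ⌈ m /2⌉
  isRadius = (centre , subst (IsEcc P centre) centre-ecc (eccentricity centre)) , minimal
    where
      centre : Fin (suc m)
      centre = fromℕ< (s≤s (⌊n/2⌋≤n m))
      centre-ecc : toℕ centre ⊔ (m ∸ toℕ centre) ≡ ⌈ m /2⌉
      centre-ecc rewrite toℕ-fromℕ< (s≤s (⌊n/2⌋≤n m)) | n∸⌊n/2⌋≡⌈n/2⌉ m =
        m≤n⇒m⊔n≡n (⌊n/2⌋≤⌈n/2⌉ m)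
      minimal : ∀ v e → IsEcc P v e → ⌈ m /2⌉ ≤ e
      minimal v e ecc rewrite IsEcc-unique ecc (eccentricity v) = ⌈n/2⌉≤m⊔[n∸m] m (toℕ v)

  interleave : ℕ → ℕ
  interleave 0             = ⌈ m /2⌉
  interleave 1             = 0
  interleave (suc (suc p)) = suc (interleave p)

  deinterleave : ℕ → ℕ
  deinterleave v with v <? ⌈ m /2⌉
  ... | yes _ = suc (v + v)
  ... | no  _ = (v ∸ ⌈ m /2⌉) + (v ∸ ⌈ m /2⌉)

  interleave-spread : ∀ p → ⌈ m /2⌉ ≤ ∣ interleave p - interleave (suc p) ∣
  interleave-spread 0             = ≤-reflexive (sym (∣-∣-identityʳ ⌈ m /2⌉))
  interleave-spread 1             = n≤1+n ⌈ m /2⌉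
  interleave-spread (suc (suc p)) = interleave-spread p

  interleave-even : ∀ t → interleave (t + t) ≡ ⌈ m /2⌉ + t
  interleave-even zero    = sym (+-identityʳ ⌈ m /2⌉)
  interleave-even (suc t) rewrite +-suc t t | +-suc ⌈ m /2⌉ t = cong suc (interleave-even t)

  interleave-odd : ∀ t → interleave (suc (t + t)) ≡ t
  interleave-odd zero    = refl
  interleave-odd (suc t) rewrite +-suc t t = cong suc (interleave-odd t)

  interleave-< : ∀ {p} → p < suc m → interleave p < suc m
  interleave-< {p} p<1+m with parity p
  ... | even t rewrite interleave-even t = s≤s (begin
    ⌈ m /2⌉ + t        ≤⟨ +-monoʳ-≤ ⌈ m /2⌉ (t+t≤n⇒t≤⌊n/2⌋ (s≤s⁻¹ p<1+m)) ⟩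
    ⌈ m /2⌉ + ⌊ m /2⌋  ≡⟨ +-comm ⌈ m /2⌉ ⌊ m /2⌋ ⟩
    ⌊ m /2⌋ + ⌈ m /2⌉  ≡⟨ ⌊n/2⌋+⌈n/2⌉≡n m ⟩
    m                  ∎)
    where open ≤-Reasoning
  ... | odd t rewrite interleave-odd t = <-trans (s≤s (m≤m+n t t)) p<1+m

  deinterleave-< : ∀ {v} → v < suc m → deinterleave v < suc m
  deinterleave-< {v} v<1+m with v <? ⌈ m /2⌉
  ... | yes v<⌈m/2⌉ = s≤s (t<⌈n/2⌉⇒1+t+t≤n v<⌈m/2⌉)
  ... | no  _       = s≤s (begin
    (v ∸ ⌈ m /2⌉) + (v ∸ ⌈ m /2⌉) ≤⟨ +-mono-≤ v∸⌈m/2⌉≤⌊m/2⌋ v∸⌈m/2⌉≤⌊m/2⌋ ⟩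
    ⌊ m /2⌋ + ⌊ m /2⌋             ≤⟨ +-monoʳ-≤ ⌊ m /2⌋ (⌊n/2⌋≤⌈n/2⌉ m) ⟩
    ⌊ m /2⌋ + ⌈ m /2⌉             ≡⟨ ⌊n/2⌋+⌈n/2⌉≡n m ⟩
    m                             ∎)
    where
      open ≤-Reasoning
      v∸⌈m/2⌉≤⌊m/2⌋ : v ∸ ⌈ m /2⌉ ≤ ⌊ m /2⌋
      v∸⌈m/2⌉≤⌊m/2⌋ = subst (v ∸ ⌈ m /2⌉ ≤_) (n∸⌈n/2⌉≡⌊n/2⌋ m) (∸-monoˡ-≤ ⌈ m /2⌉ (s≤s⁻¹ v<1+m))

  deinterleave-interleave : ∀ {p} → p < suc m → deinterleave (interleave p) ≡ p
  deinterleave-interleave {p} p<1+m with parity p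
  ... | even t rewrite interleave-even t with ⌈ m /2⌉ + t <? ⌈ m /2⌉
  ...   | yes ⌈m/2⌉+t<⌈m/2⌉ = ⊥-elim (m+n≮m ⌈ m /2⌉ t ⌈m/2⌉+t<⌈m/2⌉)
  ...   | no  _             = cong₂ _+_ (m+n∸m≡n ⌈ m /2⌉ t) (m+n∸m≡n ⌈ m /2⌉ t)
  deinterleave-interleave {p} p<1+m | odd t rewrite interleave-odd t with t <? ⌈ m /2⌉
  ...   | yes _         = refl
  ...   | no  t≮⌈m/2⌉ = ⊥-elim (t≮⌈m/2⌉ (1+t+t≤n⇒t<⌈n/2⌉ (s≤s⁻¹ p<1+m)))

  interleave-deinterleave : ∀ v → interleave (deinterleave v) ≡ v
  interleave-deinterleave v with v <? ⌈ m /2⌉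
  ... | yes _       = interleave-odd v
  ... | no  v≮⌈m/2⌉ = trans (interleave-even (v ∸ ⌈ m /2⌉)) (m+[n∸m]≡n (≮⇒≥ v≮⌈m/2⌉))

  interleaving : Σ (Labelling (suc m)) λ φ → ∀ i → toℕ (to φ i) ≡ interleave (toℕ i)
  interleaving = ⤖-from-inverses-on-range interleave deinterleave interleave-< deinterleave-<
    deinterleave-interleave (λ {v} _ → interleave-deinterleave v)

  labelling : Labelling (suc m)
  labelling = proj₁ interleaving

  toℕ-labelling : ∀ i → toℕ (to labelling i) ≡ interleave (toℕ i)
  toℕ-labelling = proj₂ interleaving

  labelling-dispersed : Dispersed P ⌈ m /2⌉ labelling
  labelling-dispersed i j j≡1+i δ d = begin
    ⌈ m /2⌉                                            ≤⟨ interleave-spread (toℕ i) ⟩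
    ∣ interleave (toℕ i) - interleave (suc (toℕ i)) ∣ ≡⟨ cong₂ ∣_-_∣ (toℕ-labelling i) toℕ-labelling-j ⟨
    ∣ toℕ (to labelling i) - toℕ (to labelling j) ∣   ≡⟨ dist-≡ d ⟨
    δ                                                  ∎
    where
      open ≤-Reasoning
      toℕ-labelling-j : toℕ (to labelling j) ≡ interleave (suc (toℕ i))
      toℕ-labelling-j = trans (toℕ-labelling j) (cong interleave j≡1+i)

  isDL : 1 ≤ m → IsDL P ⌈ m /2⌉
  isDL 1≤m = (labelling , labelling-dispersed) ,
             λ k → dispersed≤radius 1≤m adj-sym connected isRadius

theorem2p3 : ∀ (m : ℕ) → 1 ≤ m →
    ∃ λ k → IsDL (PathGraph m) k × IsRadius (PathGraph m) k × k ≡ ⌈ m /2⌉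
theorem2p3 m 1≤m = ⌈ m /2⌉ , Path.isDL m 1≤m , Path.isRadius m , refl
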